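{- For every finite simple graph $G$ on $n$ vertices and every integer $r\geqslant 2$, $$\mathrm{sat}(G,K_{1,r})\geqslant\frac{(r-1)\big(n-\alpha_{r-2}(G)\big)}{2}.$$
   Context: $K_{1,r}$ is the star graph on $r+1$ vertices. For graphs $G$ and $F$, a spanning subgraph $H$ of $G$ is an $F$-saturated subgraph of $G$ if $H$ contains no subgraph isomorphic to $F$, but for every edge $e\in E(G)\setminus E(H)$ the graph $H+e$ contains a subgraph isomorphic to $F$. $\mathrm{sat}(G,F)$ denotes the minimum number of edges of an $F$-saturated subgraph of $G$. For a nonnegative integer $k$, a set $S\subseteq V(G)$ is $k$-independent if the induced subgraph $G[S]$ has maximum degree at most $k$, and $\alpha_k(G)$ is the maximum cardinality of a $k$-independent set in $G$. -}

module Defs where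

open import Data.Nat using (ℕ; zero; suc; _+_; _<ᵇ_; _≤_)
open import Data.Empty using (⊥)
open import Data.Bool using (Bool; true; false; _∧_; _∨_; if_then_else_)
open import Data.Fin using (Fin; toℕ; _≟_)
open import Data.Fin.Subset using (Subset; _∈_; ∣_∣)
open import Data.Vec using (lookup)
open import Data.List using (List; map; allFin)
open import Data.Nat.ListAction using (sum)
open import Data.Product using (Σ; _×_)
open import Function.Definitions using (Injective)
open import Relation.Binary.PropositionalEquality using (_≡_)
open import Relation.Nullary.Decidable using (⌊_⌋)

record Graph (n : ℕ) : Set where
  field
    adj    : Fin n → Fin n → Bool
    sym    : ∀ i j → adj i j ≡ adj j i
    irrefl : ∀ i → adj i i ≡ false
open Graph public

sumFin : (n : ℕ) → (Fin n → ℕ) → ℕ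
sumFin n f = sum (map f (allFin n))

ind : Bool → ℕ
ind b = if b then 1 else 0

edgeCount : {n : ℕ} → Graph n → ℕ
edgeCount {n} G = sumFin n λ i → sumFin n λ j → ind ((toℕ i <ᵇ toℕ j) ∧ adj G i j)

SpanningSubgraph : {n : ℕ} → Graph n → Graph n → Set
SpanningSubgraph H G = ∀ i j → adj H i j ≡ true → adj G i j ≡ true

ContainsStar : {n : ℕ} → ℕ → (Fin n → Fin n → Bool) → Set
ContainsStar {n} r a =
  Σ (Fin n) λ v → Σ (Fin r → Fin n) λ f →
    Injective _≡_ _≡_ f × (∀ k → a v (f k) ≡ true)

addEdge : {n : ℕ} → Graph n → (u v : Fin n) → Fin n → Fin n → Bool
addEdge H u v x y = adj H x y ∨ ((⌊ x ≟ u ⌋ ∧ ⌊ y ≟ v ⌋) ∨ (⌊ x ≟ v ⌋ ∧ ⌊ y ≟ u ⌋))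

StarSaturated : {n : ℕ} → ℕ → Graph n → Graph n → Set
StarSaturated r G H =
  SpanningSubgraph H G
  × (ContainsStar r (adj H) → ⊥)
  × (∀ u v → adj G u v ≡ true → adj H u v ≡ false → ContainsStar r (addEdge H u v))

degIn : {n : ℕ} → Graph n → Subset n → Fin n → ℕ
degIn {n} G S i = sumFin n λ j → ind (lookup S j ∧ adj G i j)

KIndependent : {n : ℕ} → ℕ → Graph n → Subset n → Set
KIndependent k G S = ∀ i → i ∈ S → degIn G S i ≤ k

-- S is a maximum k-independent set, so ∣ S ∣ = α_k(G)
MaximumKIndependent : {n : ℕ} → ℕ → Graph n → Subset n → Set
MaximumKIndependent k G S =
  KIndependent k G S × (∀ T → KIndependent k G T → ∣ T ∣ ≤ ∣ S ∣)

module Submission where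

-- Write r = k + 2 and let H be a K_{1,r}-saturated subgraph of G.  Call a
-- vertex low if its degree in H is at most k.  If u and v are low and uv is
-- an edge of G missing from H, then H + uv contains a star K_{1,r}.  Its
-- centre is not u or v, since adding one edge raises their degree only to
-- k + 1 < r; and it is not any other vertex, since then the star would
-- already lie in H.  Hence every G-edge between low vertices is an H-edge,
-- so the set L of low vertices is k-independent in G and |L| ≤ α_k(G).
-- Every other vertex has H-degree at least k + 1, and the handshake lemma
-- gives 2|E(H)| = Σ deg_H ≥ (k + 1)(n - |L|) ≥ (r - 1)(n - α_{r-2}(G)).

open import Defs hiding (sym)
open import Data.Nat using (ℕ; zero; suc; _+_; _*_; _∸_; _≤_; _<_; _<ᵇ_; z≤n; s≤s)
open import Data.Nat.Properties
  using (+-*-semiring; _≤?_; _<?_; <-cmp; ≤-trans; ≤-reflexive; +-mono-≤; +-monoʳ-≤;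
         *-monoʳ-≤; ∸-monoʳ-≤; +-comm; +-identityʳ; *-zeroʳ; *-identityʳ; m≤n+m;
         m+n∸m≡n; ≰⇒>; 1+n≰n; module ≤-Reasoning)
open import Algebra.Properties.Semiring.Sum +-*-semiring
  using (sum-syntax; sum-cong-≗; sum-replicate-zero; ∑-distrib-+; ∑-comm; *-distribˡ-sum)
import Data.Nat.ListAction as List
open import Data.Bool using (Bool; true; false; not; _∧_; _∨_)
open import Data.Bool.Properties using (∨-identityʳ; T-≡)
open import Data.Fin using (Fin; zero; suc; toℕ; _≟_; punchIn; punchOut)
open import Data.Fin.Properties
  using (¬Fin0; any?; toℕ-injective; punchIn-injective; punchInᵢ≢i; punchOut-injective; punchIn-punchOut)
open import Data.Fin.Subset using (Subset; ∣_∣)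
open import Data.List.Properties using (map-tabulate)
open import Data.Vec using (lookup) renaming (tabulate to tabulateᵥ)
open import Data.Vec.Properties using (lookup∘tabulate; []=⇒lookup)
open import Data.Product using (_×_; _,_)
open import Data.Sum using (_⊎_; inj₁; inj₂)
open import Data.Empty using (⊥; ⊥-elim)
open import Function using (_∘_; id; Equivalence)
open import Function.Definitions using (Injective)
open import Relation.Binary using (tri<; tri≈; tri>)
open import Relation.Binary.PropositionalEquality using (_≡_; _≢_; refl; sym; trans; cong; cong₂; subst; module ≡-Reasoning)
open import Relation.Nullary using (¬_; Dec; yes; no)
open import Relation.Nullary.Decidable using (⌊_⌋; toWitness; _⊎-dec_; isYes≗does; dec-true; dec-false)

sumFin-suc : ∀ n (f : Fin (suc n) → ℕ) → sumFin (suc n) f ≡ f zero + sumFin n (f ∘ suc)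
sumFin-suc n f = cong (λ xs → f zero + List.sum xs)
  (trans (map-tabulate suc f) (sym (map-tabulate id (f ∘ suc))))

-- The list-based sums agree with the library's finite sums, whose
-- algebraic laws (distributivity, exchange of summation) are then available.
sumFin≡∑ : ∀ n (f : Fin n → ℕ) → sumFin n f ≡ ∑[ i < n ] f i
sumFin≡∑ zero    f = refl
sumFin≡∑ (suc n) f = trans (sumFin-suc n f) (cong (f zero +_) (sumFin≡∑ n (f ∘ suc)))

∑-mono : ∀ {n} {f g : Fin n → ℕ} → (∀ i → f i ≤ g i) → ∑[ i < n ] f i ≤ ∑[ i < n ] g i
∑-mono {zero}  f≤g = z≤n
∑-mono {suc n} f≤g = +-mono-≤ (f≤g zero) (∑-mono (f≤g ∘ suc))

∑-one : ∀ n → ∑[ i < n ] 1 ≡ n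
∑-one zero    = refl
∑-one (suc n) = cong suc (∑-one n)

∑-delta : ∀ {n} (w : Fin n) → ∑[ y < n ] ind ⌊ y ≟ w ⌋ ≡ 1
∑-delta {suc n} zero    = cong suc (sum-replicate-zero n)
∑-delta {suc n} (suc w) = trans (sum-cong-≗ shift) (∑-delta w)
  where
  shift : ∀ y → ind ⌊ suc y ≟ suc w ⌋ ≡ ind ⌊ y ≟ w ⌋
  shift y with y ≟ w
  ... | yes _ = refl
  ... | no  _ = refl

∑-point : ∀ {n} (b : Bool) (w : Fin n) → ∑[ y < n ] ind (b ∧ ⌊ y ≟ w ⌋) ≡ ind b
∑-point     true  w = ∑-delta w
∑-point {n} false w = sum-replicate-zero n

ind-mono : ∀ {b c} → (b ≡ true → c ≡ true) → ind b ≤ ind c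
ind-mono {false} b⇒c = z≤n
ind-mono {true}  b⇒c rewrite b⇒c refl = s≤s z≤n

ind-∨ : ∀ b c → ind (b ∨ c) ≤ ind b + ind c
ind-∨ true  c = s≤s z≤n
ind-∨ false c = ≤-reflexive refl

∧-true : ∀ {b c} → b ∧ c ≡ true → b ≡ true × c ≡ true
∧-true {true} {true} _ = refl , refl

count : (n : ℕ) → (Fin n → Bool) → ℕ
count n p = ∑[ i < n ] ind (p i)

count-complement : ∀ n (p : Fin n → Bool) → count n p + count n (not ∘ p) ≡ n
count-complement n p = begin
  count n p + count n (not ∘ p)             ≡⟨ sym (∑-distrib-+ (ind ∘ p) (ind ∘ not ∘ p)) ⟩
  ∑[ i < n ] (ind (p i) + ind (not (p i)))  ≡⟨ sum-cong-≗ (λ i → one-of (p i)) ⟩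
  ∑[ i < n ] 1                              ≡⟨ ∑-one n ⟩
  n                                         ∎
  where
  open ≡-Reasoning
  one-of : ∀ b → ind b + ind (not b) ≡ 1
  one-of true  = refl
  one-of false = refl

∣tabulate∣ : ∀ n (p : Fin n → Bool) → ∣ tabulateᵥ p ∣ ≡ count n p
∣tabulate∣ zero    p = refl
∣tabulate∣ (suc n) p with p zero
... | true  = cong suc (∣tabulate∣ n (p ∘ suc))
... | false = ∣tabulate∣ n (p ∘ suc)

-- Pigeonhole principle in counting form: r distinct elements satisfying p
-- force r ≤ count n p.  Induction on n, removing the element 0 from the range
-- (and, if 0 is hit, the one index mapped to it).
injective⇒≤count : ∀ {n r} (p : Fin n → Bool) (f : Fin r → Fin n) →
  Injective _≡_ _≡_ f → (∀ k → p (f k) ≡ true) → r ≤ count n p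

avoiding-zero : ∀ {n r} (p : Fin (suc n) → Bool) (f : Fin r → Fin (suc n)) →
  Injective _≡_ _≡_ f → (∀ k → zero ≢ f k) → (∀ k → p (f k) ≡ true) → r ≤ count n (p ∘ suc)
avoiding-zero p f inj 0∉f sat = injective⇒≤count (p ∘ suc) (λ k → punchOut (0∉f k))
  (λ eq → inj (punchOut-injective (0∉f _) (0∉f _) eq))
  (λ k → subst (λ x → p x ≡ true) (sym (punchIn-punchOut (0∉f k))) (sat k))

hitting-zero : ∀ {n r} (p : Fin (suc n) → Bool) (f : Fin r → Fin (suc n)) →
  Injective _≡_ _≡_ f → (∀ k → p (f k) ≡ true) → (k₀ : Fin r) → f k₀ ≡ zero → r ≤ count (suc n) p
hitting-zero {n} {suc r} p f inj sat k₀ fk₀≡0 =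
  subst (λ b → suc r ≤ ind b + count n (p ∘ suc)) (sym p0)
    (s≤s (avoiding-zero p (f ∘ punchIn k₀) (punchIn-injective k₀ _ _ ∘ inj) 0∉rest (sat ∘ punchIn k₀)))
  where
  p0 : p zero ≡ true
  p0 = subst (λ x → p x ≡ true) fk₀≡0 (sat k₀)
  0∉rest : ∀ k → zero ≢ f (punchIn k₀ k)
  0∉rest k 0≡f = punchInᵢ≢i k₀ k (inj (trans (sym 0≡f) (sym fk₀≡0)))

injective⇒≤count {zero} {zero}  p f inj sat = z≤n
injective⇒≤count {zero} {suc r} p f inj sat = ⊥-elim (¬Fin0 (f zero))
injective⇒≤count {suc n} p f inj sat with any? (λ k → f k ≟ zero)
... | no  0∉f          = ≤-trans (avoiding-zero p f inj (λ k 0≡fk → 0∉f (k , sym 0≡fk)) sat) (m≤n+m _ _)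
... | yes (k₀ , fk₀≡0) = hitting-zero p f inj sat k₀ fk₀≡0

⌊⌋-yes : ∀ {A : Set} (d : Dec A) → A → ⌊ d ⌋ ≡ true
⌊⌋-yes d a = trans (isYes≗does d) (dec-true d a)

⌊⌋-no : ∀ {A : Set} (d : Dec A) → ¬ A → ⌊ d ⌋ ≡ false
⌊⌋-no d ¬a = trans (isYes≗does d) (dec-false d ¬a)

degree : ∀ {n} → (Fin n → Fin n → Bool) → Fin n → ℕ
degree {n} a x = count n (a x)

<ᵇ-true : ∀ {m n} → m < n → (m <ᵇ n) ≡ true
<ᵇ-true {m} {n} = dec-true (m <? n)

<ᵇ-false : ∀ {m n} → ¬ m < n → (m <ᵇ n) ≡ false
<ᵇ-false {m} {n} = dec-false (m <? n)

-- Each ordered adjacent pair (i , j) is counted by exactly one of the edge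
-- terms i < j or j < i; loops do not occur since H is irreflexive.
ind-adj-split : ∀ {n} (H : Graph n) i j →
  ind (adj H i j) ≡ ind ((toℕ i <ᵇ toℕ j) ∧ adj H i j) + ind ((toℕ j <ᵇ toℕ i) ∧ adj H j i)
ind-adj-split H i j with <-cmp (toℕ i) (toℕ j)
... | tri< i<j _ j≮i rewrite <ᵇ-true i<j | <ᵇ-false j≮i = sym (+-identityʳ _)
... | tri> i≮j _ j<i rewrite <ᵇ-false i≮j | <ᵇ-true j<i | Graph.sym H i j = refl
... | tri≈ i≮j i≡j j≮i rewrite <ᵇ-false i≮j | <ᵇ-false j≮i | toℕ-injective i≡j | irrefl H j = refl

edgeCount≡∑ : ∀ {n} (H : Graph n) →
  edgeCount H ≡ ∑[ i < n ] ∑[ j < n ] ind ((toℕ i <ᵇ toℕ j) ∧ adj H i j)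
edgeCount≡∑ {n} H = trans (sumFin≡∑ n _) (sum-cong-≗ {n} (λ i → sumFin≡∑ n _))

handshake : ∀ {n} (H : Graph n) → ∑[ i < n ] degree (adj H) i ≡ 2 * edgeCount H
handshake {n} H = begin
  ∑[ i < n ] ∑[ j < n ] ind (adj H i j)
    ≡⟨ sum-cong-≗ (λ i → trans (sum-cong-≗ (ind-adj-split H i)) (∑-distrib-+ (forward i) (λ j → forward j i))) ⟩
  ∑[ i < n ] (∑[ j < n ] forward i j + ∑[ j < n ] forward j i)
    ≡⟨ ∑-distrib-+ (λ i → ∑[ j < n ] forward i j) (λ i → ∑[ j < n ] forward j i) ⟩
  E + ∑[ i < n ] ∑[ j < n ] forward j i
    ≡⟨ cong (E +_) (∑-comm (λ i j → forward j i)) ⟩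
  E + E
    ≡⟨ cong (E +_) (sym (+-identityʳ E)) ⟩
  2 * E
    ≡⟨ cong (2 *_) (sym (edgeCount≡∑ H)) ⟩
  2 * edgeCount H ∎
  where
  open ≡-Reasoning
  forward : Fin n → Fin n → ℕ
  forward i j = ind ((toℕ i <ᵇ toℕ j) ∧ adj H i j)
  E : ℕ
  E = ∑[ i < n ] ∑[ j < n ] forward i j

addEdge-away : ∀ {n} (H : Graph n) {u v c : Fin n} → c ≢ u → c ≢ v →
  ∀ y → addEdge H u v c y ≡ adj H c y
addEdge-away H {u} {v} {c} c≢u c≢v y
  rewrite ⌊⌋-no (c ≟ u) c≢u | ⌊⌋-no (c ≟ v) c≢v = ∨-identityʳ (adj H c y)

degree-addEdge : ∀ {n} (H : Graph n) (u v x : Fin n) →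
  degree (addEdge H u v) x ≤ degree (adj H) x + (ind ⌊ x ≟ u ⌋ + ind ⌊ x ≟ v ⌋)
degree-addEdge {n} H u v x = begin
  degree (addEdge H u v) x
    ≤⟨ ∑-mono (λ y → ind-∨₃ (adj H x y) (towards u v y) (towards v u y)) ⟩
  ∑[ y < n ] (ind (adj H x y) + (ind (towards u v y) + ind (towards v u y)))
    ≡⟨ ∑-distrib-+ (ind ∘ adj H x) _ ⟩
  degree (adj H) x + ∑[ y < n ] (ind (towards u v y) + ind (towards v u y))
    ≡⟨ cong (degree (adj H) x +_) (∑-distrib-+ (ind ∘ towards u v) (ind ∘ towards v u)) ⟩
  degree (adj H) x + (∑[ y < n ] ind (towards u v y) + ∑[ y < n ] ind (towards v u y))
    ≡⟨ cong (degree (adj H) x +_) (cong₂ _+_ (∑-point ⌊ x ≟ u ⌋ v) (∑-point ⌊ x ≟ v ⌋ u)) ⟩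
  degree (adj H) x + (ind ⌊ x ≟ u ⌋ + ind ⌊ x ≟ v ⌋) ∎
  where
  open ≤-Reasoning
  towards : Fin _ → Fin _ → Fin _ → Bool
  towards a b y = ⌊ x ≟ a ⌋ ∧ ⌊ y ≟ b ⌋
  ind-∨₃ : ∀ a b c → ind (a ∨ (b ∨ c)) ≤ ind a + (ind b + ind c)
  ind-∨₃ a b c = ≤-trans (ind-∨ a (b ∨ c)) (+-monoʳ-≤ (ind a) (ind-∨ b c))

degree-addEdge-endpoint : ∀ {n} (H : Graph n) {u v x : Fin n} → u ≢ v → x ≡ u ⊎ x ≡ v →
  degree (addEdge H u v) x ≤ suc (degree (adj H) x)
degree-addEdge-endpoint H {u} {v} u≢v (inj₁ refl) = begin
  degree (addEdge H u v) u                             ≤⟨ degree-addEdge H u v u ⟩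
  degree (adj H) u + (ind ⌊ u ≟ u ⌋ + ind ⌊ u ≟ v ⌋)  ≡⟨ cong₂ (λ a b → degree (adj H) u + (ind a + ind b))
                                                            (⌊⌋-yes (u ≟ u) refl) (⌊⌋-no (u ≟ v) u≢v) ⟩
  degree (adj H) u + 1                                 ≡⟨ +-comm _ 1 ⟩
  suc (degree (adj H) u)                               ∎
  where open ≤-Reasoning
degree-addEdge-endpoint H {u} {v} u≢v (inj₂ refl) = begin
  degree (addEdge H u v) v                             ≤⟨ degree-addEdge H u v v ⟩
  degree (adj H) v + (ind ⌊ v ≟ u ⌋ + ind ⌊ v ≟ v ⌋)  ≡⟨ cong₂ (λ a b → degree (adj H) v + (ind a + ind b))
                                                            (⌊⌋-no (v ≟ u) (u≢v ∘ sym)) (⌊⌋-yes (v ≟ v) refl) ⟩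
  degree (adj H) v + 1                                 ≡⟨ +-comm _ 1 ⟩
  suc (degree (adj H) v)                               ∎
  where open ≤-Reasoning

-- In a K_{1,k+2}-saturated subgraph H of G, every G-edge between
-- two vertices of H-degree at most k is an edge of H: otherwise H + uv has a
-- star whose centre is an endpoint (too small a degree) or another vertex
-- (whose star would already lie in H).
saturated-keeps-low-edges : ∀ {n} k (G H : Graph n) → StarSaturated (2 + k) G H →
  ∀ {u v} → degree (adj H) u ≤ k → degree (adj H) v ≤ k →
  adj G u v ≡ true → adj H u v ≡ true
saturated-keeps-low-edges k G H (_ , H-star-free , saturating) {u} {v} du≤k dv≤k uv∈G
  with adj H u v in uv∈H
... | true  = refl
... | false = ⊥-elim (no-centre (saturating u v uv∈G uv∈H))
  where
  u≢v : u ≢ v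
  u≢v refl with trans (sym uv∈G) (irrefl G u)
  ... | ()
  low-endpoint : ∀ {c} → c ≡ u ⊎ c ≡ v → degree (adj H) c ≤ k
  low-endpoint (inj₁ refl) = du≤k
  low-endpoint (inj₂ refl) = dv≤k
  centre-not-endpoint : ∀ {c} → 2 + k ≤ degree (addEdge H u v) c → c ≡ u ⊎ c ≡ v → ⊥
  centre-not-endpoint {c} big c∈uv = 1+n≰n (begin
    2 + k                     ≤⟨ big ⟩
    degree (addEdge H u v) c  ≤⟨ degree-addEdge-endpoint H u≢v c∈uv ⟩
    suc (degree (adj H) c)    ≤⟨ s≤s (low-endpoint c∈uv) ⟩
    suc k                     ∎)
    where open ≤-Reasoning
  no-centre : ContainsStar (2 + k) (addEdge H u v) → ⊥
  no-centre (c , leaves , injective , adjacent) with (c ≟ u) ⊎-dec (c ≟ v)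
  ... | yes c∈uv = centre-not-endpoint (injective⇒≤count (addEdge H u v c) leaves injective adjacent) c∈uv
  ... | no  c∉uv = H-star-free (c , leaves , injective , λ i →
    trans (sym (addEdge-away H (c∉uv ∘ inj₁) (c∉uv ∘ inj₂) (leaves i))) (adjacent i))

isLow : ∀ {n} → Graph n → ℕ → Fin n → Bool
isLow H k i = ⌊ degree (adj H) i ≤? k ⌋

lowSet : ∀ {n} → Graph n → ℕ → Subset n
lowSet H k = tabulateᵥ (isLow H k)

lowSet⇒low : ∀ {n} (H : Graph n) k {i} → lookup (lowSet H k) i ≡ true → degree (adj H) i ≤ k
lowSet⇒low H k {i} i∈L = toWitness (Equivalence.from T-≡ (trans (sym (lookup∘tabulate (isLow H k) i)) i∈L))

-- The low vertices of a K_{1,k+2}-saturated subgraph form a k-independent set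
-- of G: each of their G-neighbours inside the set is an H-neighbour.
lowSet-independent : ∀ {n} k (G H : Graph n) → StarSaturated (2 + k) G H → KIndependent k G (lowSet H k)
lowSet-independent {n} k G H saturated i i∈L = begin
  degIn G L i                                  ≡⟨ sumFin≡∑ n _ ⟩
  ∑[ j < n ] ind (lookup L j ∧ adj G i j)      ≤⟨ ∑-mono (λ j → ind-mono (kept j)) ⟩
  degree (adj H) i                             ≤⟨ lowSet⇒low H k ([]=⇒lookup i∈L) ⟩
  k                                            ∎
  where
  open ≤-Reasoning
  L : Subset n
  L = lowSet H k
  kept : ∀ j → lookup L j ∧ adj G i j ≡ true → adj H i j ≡ true
  kept j j∈L∧ij∈G with ∧-true j∈L∧ij∈G
  ... | j∈L , ij∈G = saturated-keeps-low-edges k G H saturated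
          (lowSet⇒low H k ([]=⇒lookup i∈L)) (lowSet⇒low H k j∈L) ij∈G

high-degree-bound : ∀ {n} k (H : Graph n) → suc k * (n ∸ ∣ lowSet H k ∣) ≤ ∑[ i < n ] degree (adj H) i
high-degree-bound {n} k H = begin
  suc k * (n ∸ ∣ lowSet H k ∣)                ≡⟨ cong (suc k *_) outside ⟩
  suc k * count n (not ∘ isLow H k)           ≡⟨ *-distribˡ-sum (suc k) (ind ∘ not ∘ isLow H k) ⟩
  ∑[ i < n ] (suc k * ind (not (isLow H k i))) ≤⟨ ∑-mono high ⟩
  ∑[ i < n ] degree (adj H) i                 ∎
  where
  open ≤-Reasoning
  outside : n ∸ ∣ lowSet H k ∣ ≡ count n (not ∘ isLow H k)
  outside = begin-equality
    n ∸ ∣ lowSet H k ∣                  ≡⟨ cong (n ∸_) (∣tabulate∣ n (isLow H k)) ⟩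
    n ∸ count n (isLow H k)             ≡⟨ cong (_∸ count n (isLow H k)) (sym (count-complement n (isLow H k))) ⟩
    count n (isLow H k) + count n (not ∘ isLow H k) ∸ count n (isLow H k)
                                        ≡⟨ m+n∸m≡n (count n (isLow H k)) _ ⟩
    count n (not ∘ isLow H k)           ∎
  high : ∀ i → suc k * ind (not (isLow H k i)) ≤ degree (adj H) i
  high i with degree (adj H) i ≤? k
  ... | yes _   = ≤-trans (≤-reflexive (*-zeroʳ (suc k))) z≤n
  ... | no  d≰k = ≤-trans (≤-reflexive (*-identityʳ (suc k))) (≰⇒> d≰k)

lemma4 : (n : ℕ) (G : Graph n) (r : ℕ) → 2 ≤ r →
    (H : Graph n) → StarSaturated r G H →
    (S : Subset n) → MaximumKIndependent (r ∸ 2) G S →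
    (r ∸ 1) * (n ∸ ∣ S ∣) ≤ 2 * edgeCount H
lemma4 _ _ (suc zero) (s≤s ()) _ _ _ _
lemma4 n G (suc (suc k)) _ H saturated S (_ , S-maximum) = begin
  suc k * (n ∸ ∣ S ∣)             ≤⟨ *-monoʳ-≤ (suc k) (∸-monoʳ-≤ n L≤S) ⟩
  suc k * (n ∸ ∣ lowSet H k ∣)    ≤⟨ high-degree-bound k H ⟩
  ∑[ i < n ] degree (adj H) i     ≡⟨ handshake H ⟩
  2 * edgeCount H                 ∎
  where
  open ≤-Reasoning
  L≤S : ∣ lowSet H k ∣ ≤ ∣ S ∣
  L≤S = S-maximum (lowSet H k) (lowSet-independent k G H saturated)
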